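{- Let $n\ge 2$ and let $\varphi$ be any non-negative weight function on the transpositions of $[n]=\{1,\dots,n\}$. For all permutations $\pi,\sigma\in\mathbb{S}_n$, \[ \tfrac12\, D(\pi,\sigma)\;\le\; \mathsf{d}_\varphi(\pi,\sigma)\;\le\; 2\,D(\pi,\sigma), \qquad\text{where}\quad D(\pi,\sigma)=\sum_{i=1}^n \mathrm{weight}\bigl(p^*(\pi^{ -1}(i),\sigma^{ -1}(i))\bigr). \]
   Context: $\mathbb{S}_n$ is the symmetric group on $[n]$; a permutation $\pi$ is viewed as a ranking, with $\pi(k)$ the candidate in position $k$ and $\pi^{ -1}(i)$ the position of candidate $i$. A transposition $(a\ b)$, $a\neq b\in[n]$, acts on a permutation by swapping the elements in positions $a$ and $b$. Let $\Theta$ be the set of all transpositions, and let $\varphi:\Theta\to\mathbb{R}^+$ be a non-negative weight function, $\varphi(a,b)$ denoting the weight of $(a\ b)$ (so $\varphi(a,b)=\varphi(b,a)$). The weighted transposition distance $\mathsf{d}_\varphi(\pi,\sigma)$ is the minimum total weight of a sequence of transpositions transforming $\pi$ into $\sigma$. Let $\mathcal{H}$ be the complete undirected graph on vertex set $[n]$ in which edge $\{i,j\}$ has weight $\varphi(i,j)$; $p^*(i,j)$ denotes a minimum-weight path between $i$ and $j$ in $\mathcal{H}$ and $\mathrm{weight}(p^*(i,j))$ its total weight (equal to $0$ when $i=j$). -}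

module Defs where

open import Level using (Level; _⊔_; suc)
open import Data.Nat.Base using (ℕ)
open import Data.Fin.Base using (Fin)
open import Data.Fin.Permutation using (Permutation′; _⟨$⟩ʳ_; _⟨$⟩ˡ_)
import Data.Fin.Permutation.Components as PC
open import Data.List.Base using (List; []; _∷_)
open import Data.List.Relation.Unary.Unique.Propositional using (Unique)
open import Data.Product.Base using (Σ; _×_; _,_)
open import Relation.Binary.Core using (Rel)
open import Relation.Binary.Structures using (IsTotalPreorder)
open import Relation.Binary.PropositionalEquality.Core using (_≡_; _≢_)
open import Algebra.Bundles using (CommutativeMonoid)
import Algebra.Properties.Monoid.Sum as MonoidSum

-- The weights of the paper are
-- non-negative reals; we state the theorem for weights in an arbitrary
-- totally (pre)ordered commutative monoid whose addition is monotone.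
-- The non-negative reals (ℝ, +, 0, ≤) are an instance, so the paper's
-- statement is the special case.

record WeightDomain (c ℓ₁ ℓ₂ : Level) : Set (suc (c ⊔ ℓ₁ ⊔ ℓ₂)) where
  field
    commutativeMonoid : CommutativeMonoid c ℓ₁
  open CommutativeMonoid commutativeMonoid public
    renaming (_∙_ to _+_; ε to 0#)
  infix 4 _≤_
  field
    _≤_             : Rel Carrier ℓ₂
    isTotalPreorder : IsTotalPreorder _≈_ _≤_
    +-mono-≤        : ∀ {x y u v} → x ≤ y → u ≤ v → (x + u) ≤ (y + v)

  2×_ : Carrier → Carrier
  2× x = x + x

  sumFin : ∀ {n} → (Fin n → Carrier) → Carrier
  sumFin f = MonoidSum.sum monoid f

module _ {n : ℕ} where

  record Transposition : Set where
    constructor ⟨_,_∣_⟩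
    field
      a   : Fin n
      b   : Fin n
      a≢b : a ≢ b

  -- A ranking as a function: position ↦ candidate.
  -- The transposition (a b) swaps the elements in positions a and b.
  applyT : Transposition → (Fin n → Fin n) → (Fin n → Fin n)
  applyT ⟨ a , b ∣ _ ⟩ f k = f (PC.transpose a b k)

  applySeq : List Transposition → (Fin n → Fin n) → (Fin n → Fin n)
  applySeq []       f = f
  applySeq (t ∷ ts) f = applySeq ts (applyT t f)

  Transforms : List Transposition → Permutation′ n → Permutation′ n → Set
  Transforms ts π σ = ∀ k → applySeq ts (π ⟨$⟩ʳ_) k ≡ σ ⟨$⟩ʳ k

module _ {n : ℕ} where

  data Walk : Fin n → Fin n → Set where
    stay : ∀ {i} → Walk i i
    step : ∀ {i j} k → i ≢ k → Walk k j → Walk i j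

  vertices : ∀ {i j} → Walk i j → List (Fin n)
  vertices {i} stay          = i ∷ []
  vertices {i} (step k _ w)  = i ∷ vertices w

  IsPath : ∀ {i j} → Walk i j → Set
  IsPath w = Unique (vertices w)

module _ {c ℓ₁ ℓ₂} (W : WeightDomain c ℓ₁ ℓ₂) {n : ℕ} where
  open WeightDomain W

  seqWeight : (Fin n → Fin n → Carrier) → List (Transposition {n}) → Carrier
  seqWeight φ []                  = 0#
  seqWeight φ (⟨ a , b ∣ _ ⟩ ∷ ts) = φ a b + seqWeight φ ts

  walkWeight : (Fin n → Fin n → Carrier) → ∀ {i j} → Walk {n} i j → Carrier
  walkWeight φ stay             = 0#
  walkWeight φ {i} (step k _ w) = φ i k + walkWeight φ w

  IsWeightFunction : (Fin n → Fin n → Carrier) → Set (ℓ₁ ⊔ ℓ₂)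
  IsWeightFunction φ =
    (∀ a b → φ a b ≈ φ b a) × (∀ a b → a ≢ b → 0# ≤ φ a b)

  -- δ i j = weight (p*(i,j)): the weight of a minimum-weight path
  IsMinPathWeight : (Fin n → Fin n → Carrier) → (Fin n → Fin n → Carrier)
                  → Set (ℓ₁ ⊔ ℓ₂)
  IsMinPathWeight φ δ =
    ∀ i j → Σ (Walk i j) (λ p → IsPath p × walkWeight φ p ≈ δ i j)
          × (∀ (q : Walk i j) → IsPath q → δ i j ≤ walkWeight φ q)

  Dist : (Fin n → Fin n → Carrier) → Permutation′ n → Permutation′ n → Carrier
  Dist δ π σ = sumFin (λ i → δ (π ⟨$⟩ˡ i) (σ ⟨$⟩ˡ i))

-- The lower bound: a transposition of the positions a and b moves only two
-- candidates, each across the edge {a, b}, so by the triangle inequality for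
-- minimum path weights D drops by at most 2 φ(a, b).
--
-- The upper bound: fix a misplaced candidate x, at position h.  The candidate
-- y that belongs at h sits at some position p; exchanging p and h along a
-- shortest path costs at most 2 δ(p, h), sends y home and moves x on to p.
-- Iterating along the cycle of x, every other candidate of the cycle is
-- charged twice its own term of D and x arrives home for free.  Each step
-- strictly enlarges the set of correctly filled positions, so this terminates.

module Submission where

open import Defs
open import Data.Nat.Base using (ℕ; zero; suc)
open import Data.Fin.Base using (Fin; zero; suc)
open import Data.Fin.Properties using (_≟_; all?; ¬∀⟶∃¬)
open import Data.Fin.Permutation
  using (Permutation′; _⟨$⟩ʳ_; _⟨$⟩ˡ_; inverseˡ; inverseʳ; transpose; _∘ₚ_)
import Data.Fin.Permutation.Components as PC
open import Data.Fin.Subset using (Subset; _∈_; _⊃_)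
open import Data.Fin.Subset.Induction using (⊃-wellFounded; Acc; acc)
open import Data.Vec.Base using (tabulate)
open import Data.Vec.Properties using ([]=⇒lookup; lookup⇒[]=; lookup∘tabulate)
open import Data.Vec.Functional using (updateAt)
open import Data.Vec.Functional.Properties using (updateAt-updates; updateAt-minimal)
open import Data.List.Base using (List; []; _∷_; _++_; [_])
open import Data.List.Membership.Propositional using () renaming (_∈_ to _∈ₗ_)
open import Data.List.Relation.Unary.Any using (any?; here; there)
open import Data.List.Relation.Unary.All using ([])
open import Data.List.Relation.Unary.All.Properties using (¬Any⇒All¬)
open import Data.List.Relation.Unary.AllPairs using (_∷_; [])
open import Data.Product.Base using (Σ; _×_; _,_; proj₁; proj₂)
open import Data.Empty using (⊥-elim)
open import Function.Base using (_∘_)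
open import Function.Bundles using (Inverse)
open import Relation.Nullary using (Dec; yes; no; does)
open import Relation.Nullary.Decidable using (dec-true; dec-false)
open import Relation.Binary.Structures using (IsTotalPreorder)
import Relation.Binary.Reasoning.Base.Double
open import Relation.Binary.PropositionalEquality
  using (_≡_; _≢_; _≗_; refl; sym; trans; cong; cong₂; module ≡-Reasoning)

module _ {n : ℕ} where

  transpose-matchˡ : (i j : Fin n) → PC.transpose i j i ≡ j
  transpose-matchˡ i j rewrite dec-true (i ≟ i) refl = refl

  transpose-matchʳ : (i j : Fin n) → PC.transpose i j j ≡ i
  transpose-matchʳ i j with j ≟ i
  ... | yes refl = refl
  ... | no _ rewrite dec-true (j ≟ j) refl = refl

  transpose-mismatch : ∀ {i j k : Fin n} → k ≢ i → k ≢ j → PC.transpose i j k ≡ k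
  transpose-mismatch {i} {j} {k} k≢i k≢j
    rewrite dec-false (k ≟ i) k≢i | dec-false (k ≟ j) k≢j = refl

  transpose-conjugate : ∀ {p k h : Fin n} → p ≢ k → k ≢ h → p ≢ h →
    PC.transpose p k ∘ PC.transpose k h ∘ PC.transpose p k ≗ PC.transpose p h
  transpose-conjugate {p} {k} {h} p≢k k≢h p≢h x = cases (x ≟ p) (x ≟ k) (x ≟ h)
    where
    open ≡-Reasoning
    τ = PC.transpose

    cases : Dec (x ≡ p) → Dec (x ≡ k) → Dec (x ≡ h) → τ p k (τ k h (τ p k x)) ≡ τ p h x
    cases (yes refl) _ _ = begin
      τ x k (τ k h (τ x k x)) ≡⟨ cong (τ x k ∘ τ k h) (transpose-matchˡ x k) ⟩
      τ x k (τ k h k)         ≡⟨ cong (τ x k) (transpose-matchˡ k h) ⟩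
      τ x k h                 ≡⟨ transpose-mismatch (p≢h ∘ sym) (k≢h ∘ sym) ⟩
      h                       ≡⟨ transpose-matchˡ x h ⟨
      τ x h x                 ∎
    cases (no _) (yes refl) _ = begin
      τ p x (τ x h (τ p x x)) ≡⟨ cong (τ p x ∘ τ x h) (transpose-matchʳ p x) ⟩
      τ p x (τ x h p)         ≡⟨ cong (τ p x) (transpose-mismatch p≢k p≢h) ⟩
      τ p x p                 ≡⟨ transpose-matchˡ p x ⟩
      x                       ≡⟨ transpose-mismatch (p≢k ∘ sym) k≢h ⟨
      τ p h x                 ∎
    cases (no x≢p) (no x≢k) (yes refl) = begin
      τ p k (τ k x (τ p k x)) ≡⟨ cong (τ p k ∘ τ k x) (transpose-mismatch x≢p x≢k) ⟩
      τ p k (τ k x x)         ≡⟨ cong (τ p k) (transpose-matchʳ k x) ⟩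
      τ p k k                 ≡⟨ transpose-matchʳ p k ⟩
      p                       ≡⟨ transpose-matchʳ p x ⟨
      τ p x x                 ∎
    cases (no x≢p) (no x≢k) (no x≢h) = begin
      τ p k (τ k h (τ p k x)) ≡⟨ cong (τ p k ∘ τ k h) (transpose-mismatch x≢p x≢k) ⟩
      τ p k (τ k h x)         ≡⟨ cong (τ p k) (transpose-mismatch x≢k x≢h) ⟩
      τ p k x                 ≡⟨ transpose-mismatch x≢p x≢k ⟩
      x                       ≡⟨ transpose-mismatch x≢p x≢h ⟨
      τ p h x                 ∎

  Realizes : List (Transposition {n}) → (Fin n → Fin n) → Set
  Realizes ts g = ∀ f → applySeq ts f ≗ f ∘ g

  applySeq-cong : ∀ ts {f g : Fin n → Fin n} → f ≗ g → applySeq ts f ≗ applySeq ts g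
  applySeq-cong []                     f≗g = f≗g
  applySeq-cong (⟨ a , b ∣ _ ⟩ ∷ ts) f≗g = applySeq-cong ts (f≗g ∘ PC.transpose a b)

  applySeq-++ : ∀ ts us (f : Fin n → Fin n) → applySeq (ts ++ us) f ≡ applySeq us (applySeq ts f)
  applySeq-++ []       us f = refl
  applySeq-++ (t ∷ ts) us f = applySeq-++ ts us (applyT t f)

  Realizes-[_] : ∀ {a b} (a≢b : a ≢ b) → Realizes [ ⟨ a , b ∣ a≢b ⟩ ] (PC.transpose a b)
  Realizes-[ _ ] f x = refl

  Realizes-++ : ∀ ts us {g g′} → Realizes ts g → Realizes us g′ → Realizes (ts ++ us) (g ∘ g′)
  Realizes-++ ts us {g′ = g′} ts-g us-g′ f x rewrite applySeq-++ ts us f =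
    trans (us-g′ (applySeq ts f) x) (ts-g f (g′ x))

  ⟨$⟩ˡ≡⇒⟨$⟩ʳ≡ : ∀ (π : Permutation′ n) {i a} → π ⟨$⟩ˡ i ≡ a → π ⟨$⟩ʳ a ≡ i
  ⟨$⟩ˡ≡⇒⟨$⟩ʳ≡ π eq = Inverse.inverseˡ π (sym eq)

  ⟨$⟩ʳ≡⇒⟨$⟩ˡ≡ : ∀ (π : Permutation′ n) {i a} → π ⟨$⟩ʳ a ≡ i → π ⟨$⟩ˡ i ≡ a
  ⟨$⟩ʳ≡⇒⟨$⟩ˡ≡ π eq = Inverse.inverseʳ π (sym eq)

  ⟨$⟩ʳ-injective : ∀ (π : Permutation′ n) {a b} → π ⟨$⟩ʳ a ≡ π ⟨$⟩ʳ b → a ≡ b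
  ⟨$⟩ʳ-injective π eq = trans (sym (inverseˡ π)) (Inverse.inverseʳ π eq)

  ⟨$⟩ˡ-injective : ∀ (π : Permutation′ n) {i j} → π ⟨$⟩ˡ i ≡ π ⟨$⟩ˡ j → i ≡ j
  ⟨$⟩ˡ-injective π eq = trans (sym (inverseʳ π)) (Inverse.inverseˡ π eq)

  module _ (π : Permutation′ n) {a b i : Fin n} where

    transpose∘ₚ-matchˡ : π ⟨$⟩ˡ i ≡ a → (transpose a b ∘ₚ π) ⟨$⟩ˡ i ≡ b
    transpose∘ₚ-matchˡ eq = trans (cong (PC.transpose b a) eq) (transpose-matchʳ b a)

    transpose∘ₚ-matchʳ : π ⟨$⟩ˡ i ≡ b → (transpose a b ∘ₚ π) ⟨$⟩ˡ i ≡ a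
    transpose∘ₚ-matchʳ eq = trans (cong (PC.transpose b a) eq) (transpose-matchˡ b a)

    transpose∘ₚ-mismatch : π ⟨$⟩ˡ i ≢ a → π ⟨$⟩ˡ i ≢ b →
                           (transpose a b ∘ₚ π) ⟨$⟩ˡ i ≡ π ⟨$⟩ˡ i
    transpose∘ₚ-mismatch ≢a ≢b = transpose-mismatch ≢b ≢a

  module _ (π σ : Permutation′ n) where

    Transforms-[]⇒⟨$⟩ˡ≡ : Transforms [] π σ → ∀ i → π ⟨$⟩ˡ i ≡ σ ⟨$⟩ˡ i
    Transforms-[]⇒⟨$⟩ˡ≡ π≗σ i =
      sym (Inverse.inverseʳ σ (trans (sym (inverseʳ π)) (π≗σ (π ⟨$⟩ˡ i))))

    ⟨$⟩ˡ≡⇒Transforms-[] : (∀ i → π ⟨$⟩ˡ i ≡ σ ⟨$⟩ˡ i) → Transforms [] π σ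
    ⟨$⟩ˡ≡⇒Transforms-[] π⁻¹≗σ⁻¹ k =
      Inverse.inverseˡ π (sym (trans (π⁻¹≗σ⁻¹ (σ ⟨$⟩ʳ k)) (inverseˡ σ)))

    Transforms-++ : ∀ ts {us} (ρ : Permutation′ n) → Realizes ts (ρ ⟨$⟩ʳ_) →
                    Transforms us (ρ ∘ₚ π) σ → Transforms (ts ++ us) π σ
    Transforms-++ ts {us} ρ ts-ρ us-tf k rewrite applySeq-++ ts us (π ⟨$⟩ʳ_) =
      trans (applySeq-cong us (ts-ρ (π ⟨$⟩ʳ_)) k) (us-tf k)

module WeightDomainProperties {c ℓ₁ ℓ₂} (W : WeightDomain c ℓ₁ ℓ₂) where

  open WeightDomain W renaming (refl to ≈-refl; sym to ≈-sym; trans to ≈-trans)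
  open IsTotalPreorder isTotalPreorder public
    using (isPreorder) renaming (refl to ≤-refl; trans to ≤-trans; reflexive to ≤-reflexive)
  open import Algebra.Solver.CommutativeMonoid commutativeMonoid using (solve; _⊕_; _⊜_)

  module ≤-Reasoning = Relation.Binary.Reasoning.Base.Double isPreorder

  x≤x+y : ∀ {x y} → 0# ≤ y → x ≤ x + y
  x≤x+y {x} h = ≤-trans (≤-reflexive (≈-sym (identityʳ x))) (+-mono-≤ ≤-refl h)

  x≤y+x : ∀ {x y} → 0# ≤ y → x ≤ y + x
  x≤y+x {x} h = ≤-trans (≤-reflexive (≈-sym (identityˡ x))) (+-mono-≤ h ≤-refl)

  +-nonneg : ∀ {x y} → 0# ≤ x → 0# ≤ y → 0# ≤ x + y
  +-nonneg hx hy = ≤-trans hx (x≤x+y hy)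

  2×-mono : ∀ {x y} → x ≤ y → 2× x ≤ 2× y
  2×-mono h = +-mono-≤ h h

  2×-distrib : ∀ x y → 2× (x + y) ≈ 2× x + 2× y
  2×-distrib = solve 2 (λ x y → (x ⊕ y) ⊕ (x ⊕ y) ⊜ (x ⊕ x) ⊕ (y ⊕ y)) ≈-refl

  sum-mono : ∀ {m} {f g : Fin m → Carrier} → (∀ i → f i ≤ g i) → sumFin f ≤ sumFin g
  sum-mono {zero}  f≤g = ≤-refl
  sum-mono {suc m} f≤g = +-mono-≤ (f≤g zero) (sum-mono (f≤g ∘ suc))

  sum-nonneg : ∀ {m} {f : Fin m → Carrier} → (∀ i → 0# ≤ f i) → 0# ≤ sumFin f
  sum-nonneg {zero}  f≥0 = ≤-refl
  sum-nonneg {suc m} f≥0 = +-nonneg (f≥0 zero) (sum-nonneg (f≥0 ∘ suc))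

  sum-nonpos : ∀ {m} {f : Fin m → Carrier} → (∀ i → f i ≤ 0#) → sumFin f ≤ 0#
  sum-nonpos {zero}  f≤0 = ≤-refl
  sum-nonpos {suc m} f≤0 =
    ≤-trans (+-mono-≤ (f≤0 zero) (sum-nonpos (f≤0 ∘ suc))) (≤-reflexive (identityˡ 0#))

  sum-updateAt-+ : ∀ {m} (t : Fin m → Carrier) i x → sumFin (updateAt t i (x +_)) ≈ x + sumFin t
  sum-updateAt-+ t zero    x = assoc x (t zero) _
  sum-updateAt-+ t (suc i) x =
    ≈-trans (∙-congˡ (sum-updateAt-+ (t ∘ suc) i x))
            (solve 3 (λ a b s → a ⊕ (b ⊕ s) ⊜ b ⊕ (a ⊕ s)) ≈-refl (t zero) x _)

  sum-updateAt-0# : ∀ {m} (t : Fin m → Carrier) i →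
                    sumFin t ≈ t i + sumFin (updateAt t i (λ _ → 0#))
  sum-updateAt-0# t zero    = ∙-congˡ (≈-sym (identityˡ _))
  sum-updateAt-0# t (suc i) =
    ≈-trans (∙-congˡ (sum-updateAt-0# (t ∘ suc) i))
            (solve 3 (λ a b s → a ⊕ (b ⊕ s) ⊜ b ⊕ (a ⊕ s)) ≈-refl (t zero) (t (suc i)) _)

  seqWeight-++ : ∀ {n} (φ : Fin n → Fin n → Carrier) ts us →
                 seqWeight W φ (ts ++ us) ≈ seqWeight W φ ts + seqWeight W φ us
  seqWeight-++ φ []                   us = ≈-sym (identityˡ _)
  seqWeight-++ φ (⟨ a , b ∣ _ ⟩ ∷ ts) us =
    ≈-trans (∙-congˡ (seqWeight-++ φ ts us)) (≈-sym (assoc _ _ _))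

module Walks {c ℓ₁ ℓ₂} (W : WeightDomain c ℓ₁ ℓ₂) {n : ℕ}
  {φ : Fin n → Fin n → WeightDomain.Carrier W}
  (φ-nonneg : ∀ a b → a ≢ b → WeightDomain._≤_ W (WeightDomain.0# W) (φ a b)) where

  open WeightDomain W renaming (refl to ≈-refl; sym to ≈-sym; trans to ≈-trans)
  open WeightDomainProperties W
  open import Algebra.Solver.CommutativeMonoid commutativeMonoid using (solve; _⊕_; _⊜_; id)

  weight : ∀ {i j} → Walk i j → Carrier
  weight = walkWeight W φ

  weight-nonneg : ∀ {i j} (w : Walk i j) → 0# ≤ weight w
  weight-nonneg stay           = ≤-refl
  weight-nonneg (step _ i≢k w) = +-nonneg (φ-nonneg _ _ i≢k) (weight-nonneg w)

  suffixPath : ∀ {i k j} (q : Walk k j) → IsPath q → i ∈ₗ vertices q →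
               Σ (Walk i j) λ r → IsPath r × weight r ≤ weight q
  suffixPath q@stay           q-path       (here refl)  = q , q-path , ≤-refl
  suffixPath q@(step _ _ _)   q-path       (here refl)  = q , q-path , ≤-refl
  suffixPath (step _ k≢m q) (_ ∷ q-path) (there i∈q) with suffixPath q q-path i∈q
  ... | r , r-path , r≤q = r , r-path , ≤-trans r≤q (x≤y+x (φ-nonneg _ _ k≢m))

  walk⇒path : ∀ {i j} (w : Walk i j) → Σ (Walk i j) λ q → IsPath q × weight q ≤ weight w
  walk⇒path stay = stay , [] ∷ [] , ≤-refl
  walk⇒path {i} (step k i≢k w) with walk⇒path w
  ... | q , q-path , q≤w with any? (i ≟_) (vertices q)
  ...   | yes i∈q = let r , r-path , r≤q = suffixPath q q-path i∈q in
                    r , r-path , ≤-trans r≤q (≤-trans q≤w (x≤y+x (φ-nonneg _ _ i≢k)))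
  ...   | no  i∉q = step k i≢k q , ¬Any⇒All¬ _ i∉q ∷ q-path , +-mono-≤ ≤-refl q≤w

  -- Along p → k → ⋯ → h, the transposition (p h) is (p k) (k h) (p k):
  -- every edge of the walk is used at most twice.
  transpositionsAlong : ∀ {p h} (w : Walk p h) → p ≢ h →
    Σ (List Transposition) λ ts → Realizes ts (PC.transpose p h) × seqWeight W φ ts ≤ 2× weight w
  transpositionsAlong stay p≢p = ⊥-elim (p≢p refl)
  transpositionsAlong {p} {h} (step k p≢k w) p≢h with k ≟ h
  ... | yes refl =
    [ ⟨ p , k ∣ p≢k ⟩ ] , Realizes-[ p≢k ] ,
    +-mono-≤ (x≤x+y (weight-nonneg w)) (weight-nonneg (step k p≢k w))
  ... | no k≢h with transpositionsAlong w k≢h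
  ...   | ts , ts-kh , ts≤2w = pk ∷ ts ++ [ pk ] , realizes , bound
    where
    pk = ⟨ p , k ∣ p≢k ⟩
    realizes : Realizes (pk ∷ ts ++ [ pk ]) (PC.transpose p h)
    realizes f x =
      trans (Realizes-++ [ pk ] (ts ++ [ pk ]) Realizes-[ p≢k ]
                         (Realizes-++ ts [ pk ] ts-kh Realizes-[ p≢k ]) f x)
            (cong f (transpose-conjugate p≢k k≢h p≢h x))
    bound : φ p k + seqWeight W φ (ts ++ [ pk ]) ≤ 2× (φ p k + weight w)
    bound = begin
      φ p k + seqWeight W φ (ts ++ [ pk ])       ≈⟨ ∙-congˡ (seqWeight-++ φ ts [ pk ]) ⟩
      φ p k + (seqWeight W φ ts + (φ p k + 0#))  ≲⟨ +-mono-≤ ≤-refl (+-mono-≤ ts≤2w ≤-refl) ⟩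
      φ p k + (2× weight w + (φ p k + 0#))       ≈⟨ rearrange (φ p k) (weight w) ⟩
      2× (φ p k + weight w)                      ∎
      where
      open ≤-Reasoning
      rearrange = solve 2 (λ a b → a ⊕ ((b ⊕ b) ⊕ (a ⊕ id)) ⊜ (a ⊕ b) ⊕ (a ⊕ b)) ≈-refl

module MinPathWeights {c ℓ₁ ℓ₂} (W : WeightDomain c ℓ₁ ℓ₂) {n : ℕ}
  {φ : Fin n → Fin n → WeightDomain.Carrier W}
  (φ-nonneg : ∀ a b → a ≢ b → WeightDomain._≤_ W (WeightDomain.0# W) (φ a b))
  {δ : Fin n → Fin n → WeightDomain.Carrier W} (δ-minimal : IsMinPathWeight W φ δ) where

  open WeightDomain W renaming (refl to ≈-refl; sym to ≈-sym; trans to ≈-trans)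
  open WeightDomainProperties W
  open Walks W φ-nonneg

  δ≤weight : ∀ {i j} (w : Walk i j) → δ i j ≤ weight w
  δ≤weight {i} {j} w =
    let q , q-path , q≤w = walk⇒path w in ≤-trans (proj₂ (δ-minimal i j) q q-path) q≤w

  δ-nonneg : ∀ i j → 0# ≤ δ i j
  δ-nonneg i j =
    let q , _ , q≈δ = proj₁ (δ-minimal i j) in ≤-trans (weight-nonneg q) (≤-reflexive q≈δ)

  δ-diagonal : ∀ i → δ i i ≤ 0#
  δ-diagonal i = δ≤weight stay

  δ-triangle : ∀ {a b} s → a ≢ b → δ a s ≤ φ a b + δ b s
  δ-triangle {b = b} s a≢b =
    let q , _ , q≈δ = proj₁ (δ-minimal b s) in
    ≤-trans (δ≤weight (step b a≢b q)) (+-mono-≤ ≤-refl (≤-reflexive q≈δ))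

  transpositionsAlongShortestPath : ∀ {p h} → p ≢ h →
    Σ (List Transposition) λ ts → Realizes ts (PC.transpose p h) × seqWeight W φ ts ≤ 2× δ p h
  transpositionsAlongShortestPath {p} {h} p≢h =
    let q , _ , q≈δ = proj₁ (δ-minimal p h)
        ts , ts-ph , ts≤2q = transpositionsAlong q p≢h
    in ts , ts-ph , ≤-trans ts≤2q (2×-mono (≤-reflexive q≈δ))

module TranspositionDistance {c ℓ₁ ℓ₂} (W : WeightDomain c ℓ₁ ℓ₂) {n : ℕ}
  {φ : Fin n → Fin n → WeightDomain.Carrier W} (φ-weight : IsWeightFunction W φ)
  {δ : Fin n → Fin n → WeightDomain.Carrier W} (δ-minimal : IsMinPathWeight W φ δ)
  (σ : Permutation′ n) where

  open WeightDomain W renaming (refl to ≈-refl; sym to ≈-sym; trans to ≈-trans)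
  open WeightDomainProperties W
  open MinPathWeights W (proj₂ φ-weight) δ-minimal

  term : Permutation′ n → Fin n → Carrier
  term π i = δ (π ⟨$⟩ˡ i) (σ ⟨$⟩ˡ i)

  D : Permutation′ n → Carrier
  D π = Dist W δ π σ

  cost : List Transposition → Carrier
  cost = seqWeight W φ

  term-placed : ∀ π {i} → π ⟨$⟩ˡ i ≡ σ ⟨$⟩ˡ i → term π i ≤ 0#
  term-placed π {i} eq rewrite eq = δ-diagonal (σ ⟨$⟩ˡ i)

  D-transpose : ∀ {a b} π → a ≢ b → D π ≤ 2× φ a b + D (transpose a b ∘ₚ π)
  D-transpose {a} {b} π a≢b = begin
    sumFin (term π)                                         ≲⟨ sum-mono pointwise ⟩
    sumFin (updateAt (updateAt (term π′) x (w +_)) y (w +_)) ≈⟨ sum-updateAt-+ _ y w ⟩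
    w + sumFin (updateAt (term π′) x (w +_))                 ≈⟨ ∙-congˡ (sum-updateAt-+ (term π′) x w) ⟩
    w + (w + D π′)                                           ≈⟨ assoc w w _ ⟨
    2× w + D π′                                              ∎
    where
    open ≤-Reasoning
    w = φ a b
    π′ = transpose a b ∘ₚ π
    x = π ⟨$⟩ʳ a
    y = π ⟨$⟩ʳ b
    y≢x : y ≢ x
    y≢x = a≢b ∘ sym ∘ ⟨$⟩ʳ-injective π

    pointwise : ∀ i → term π i ≤ updateAt (updateAt (term π′) x (w +_)) y (w +_) i
    pointwise i with i ≟ y | i ≟ x
    ... | yes refl | _ = begin
      δ (π ⟨$⟩ˡ y) s            ≡⟨ cong (λ k → δ k s) (inverseˡ π) ⟩
      δ b s                     ≲⟨ δ-triangle s (a≢b ∘ sym) ⟩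
      φ b a + δ a s             ≈⟨ ∙-congʳ (proj₁ φ-weight b a) ⟩
      w + δ a s                 ≡⟨ cong (λ k → w + δ k s) (transpose∘ₚ-matchʳ π (inverseˡ π)) ⟨
      w + term π′ y             ≡⟨ cong (w +_) (updateAt-minimal y x (term π′) y≢x) ⟨
      w + updateAt (term π′) x (w +_) y ≡⟨ updateAt-updates y _ ⟨
      updateAt (updateAt (term π′) x (w +_)) y (w +_) y ∎
      where s = σ ⟨$⟩ˡ y
    ... | no i≢y | yes refl = begin
      δ (π ⟨$⟩ˡ x) s            ≡⟨ cong (λ k → δ k s) (inverseˡ π) ⟩
      δ a s                     ≲⟨ δ-triangle s a≢b ⟩
      w + δ b s                 ≡⟨ cong (λ k → w + δ k s) (transpose∘ₚ-matchˡ π (inverseˡ π)) ⟨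
      w + term π′ x             ≡⟨ updateAt-updates x (term π′) ⟨
      updateAt (term π′) x (w +_) x ≡⟨ updateAt-minimal x y _ i≢y ⟨
      updateAt (updateAt (term π′) x (w +_)) y (w +_) x ∎
      where s = σ ⟨$⟩ˡ x
    ... | no i≢y | no i≢x = begin
      term π i    ≡⟨ cong (λ k → δ k (σ ⟨$⟩ˡ i)) (transpose∘ₚ-mismatch π ≢a ≢b) ⟨
      term π′ i   ≡⟨ updateAt-minimal i x (term π′) i≢x ⟨
      updateAt (term π′) x (w +_) i ≡⟨ updateAt-minimal i y _ i≢y ⟨
      updateAt (updateAt (term π′) x (w +_)) y (w +_) i ∎
      where
      ≢a : π ⟨$⟩ˡ i ≢ a
      ≢a = i≢x ∘ sym ∘ ⟨$⟩ˡ≡⇒⟨$⟩ʳ≡ π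
      ≢b : π ⟨$⟩ˡ i ≢ b
      ≢b = i≢y ∘ sym ∘ ⟨$⟩ˡ≡⇒⟨$⟩ʳ≡ π

  lower-bound : ∀ ts π → Transforms ts π σ → D π ≤ 2× cost ts
  lower-bound [] π π≗σ =
    ≤-trans (sum-nonpos (term-placed π ∘ Transforms-[]⇒⟨$⟩ˡ≡ π σ π≗σ))
            (≤-reflexive (≈-sym (identityʳ 0#)))
  lower-bound (⟨ a , b ∣ a≢b ⟩ ∷ ts) π π⇝σ = begin
    D π                          ≲⟨ D-transpose π a≢b ⟩
    2× φ a b + D π′              ≲⟨ +-mono-≤ ≤-refl (lower-bound ts π′ π⇝σ) ⟩
    2× φ a b + 2× cost ts        ≈⟨ 2×-distrib (φ a b) (cost ts) ⟨
    2× (φ a b + cost ts)         ∎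
    where
    open ≤-Reasoning
    π′ = transpose a b ∘ₚ π

  D-nonneg : ∀ π → 0# ≤ D π
  D-nonneg π = sum-nonneg {f = term π} λ i → δ-nonneg _ _

  D-except : Fin n → Permutation′ n → Carrier
  D-except x π = sumFin (updateAt (term π) x λ _ → 0#)

  D-except≤D : ∀ x π → D-except x π ≤ D π
  D-except≤D x π =
    ≤-trans (x≤y+x (δ-nonneg _ _)) (≤-reflexive (≈-sym (sum-updateAt-0# (term π) x)))

  D≤D-except : ∀ {x π} → π ⟨$⟩ˡ x ≡ σ ⟨$⟩ˡ x → D π ≤ D-except x π
  D≤D-except {x} {π} x-home = begin
    D π                       ≈⟨ sum-updateAt-0# (term π) x ⟩
    term π x + D-except x π   ≲⟨ +-mono-≤ (term-placed π x-home) ≤-refl ⟩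
    0# + D-except x π         ≈⟨ identityˡ _ ⟩
    D-except x π              ∎
    where open ≤-Reasoning

  ReachableWithin : Permutation′ n → Carrier → Set ℓ₂
  ReachableWithin π b = Σ (List Transposition) λ ts → Transforms ts π σ × cost ts ≤ b

  ReachableWithin-mono : ∀ {π b b′} → b ≤ b′ → ReachableWithin π b → ReachableWithin π b′
  ReachableWithin-mono b≤b′ (ts , ts-tf , ts≤b) = ts , ts-tf , ≤-trans ts≤b b≤b′

  matched : Permutation′ n → Subset n
  matched π = tabulate λ k → does (π ⟨$⟩ʳ k ≟ σ ⟨$⟩ʳ k)

  ∈-matched⁺ : ∀ π {k} → π ⟨$⟩ʳ k ≡ σ ⟨$⟩ʳ k → k ∈ matched π
  ∈-matched⁺ π {k} eq =
    lookup⇒[]= k (matched π)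
      (trans (lookup∘tabulate _ k) (dec-true (π ⟨$⟩ʳ k ≟ σ ⟨$⟩ʳ k) eq))

  ∈-matched⁻ : ∀ π {k} → k ∈ matched π → π ⟨$⟩ʳ k ≡ σ ⟨$⟩ʳ k
  ∈-matched⁻ π {k} k∈
    with π ⟨$⟩ʳ k ≟ σ ⟨$⟩ʳ k | trans (sym (lookup∘tabulate _ k)) ([]=⇒lookup k∈)
  ... | yes eq | _  = eq
  ... | no _   | ()

  module SendHome (π : Permutation′ n) (x : Fin n) (x-misplaced : π ⟨$⟩ˡ x ≢ σ ⟨$⟩ˡ x) where

    h = π ⟨$⟩ˡ x
    y = σ ⟨$⟩ʳ h
    p = π ⟨$⟩ˡ y
    π′ = transpose p h ∘ₚ π

    y≢x : y ≢ x
    y≢x y≡x = x-misplaced (sym (⟨$⟩ʳ≡⇒⟨$⟩ˡ≡ σ y≡x))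

    p≢h : p ≢ h
    p≢h = y≢x ∘ ⟨$⟩ˡ-injective π

    p-unmatched : π ⟨$⟩ʳ p ≢ σ ⟨$⟩ʳ p
    p-unmatched eq = p≢h (⟨$⟩ʳ-injective σ (trans (sym eq) (inverseʳ π)))

    h-unmatched : π ⟨$⟩ʳ h ≢ σ ⟨$⟩ʳ h
    h-unmatched eq = y≢x (sym (trans (sym (inverseʳ π)) eq))

    matched-grows : matched π′ ⊃ matched π
    matched-grows = stays-matched , h , ∈-matched⁺ π′ h-home , h-unmatched ∘ ∈-matched⁻ π
      where
      stays-matched : ∀ {k} → k ∈ matched π → k ∈ matched π′
      stays-matched {k} k∈ =
        ∈-matched⁺ π′ (trans (cong (π ⟨$⟩ʳ_) (transpose-mismatch k≢p k≢h)) k-home)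
        where
        k-home = ∈-matched⁻ π k∈
        k≢p : k ≢ p
        k≢p refl = p-unmatched k-home
        k≢h : k ≢ h
        k≢h refl = h-unmatched k-home
      h-home : π′ ⟨$⟩ʳ h ≡ σ ⟨$⟩ʳ h
      h-home = trans (cong (π ⟨$⟩ʳ_) (transpose-matchʳ p h)) (inverseʳ π)

    D-except-decreases : δ p h + D-except x π′ ≤ D-except x π
    D-except-decreases = begin
      δ p h + D-except x π′                                   ≈⟨ sum-updateAt-+ _ y (δ p h) ⟨
      sumFin (updateAt (updateAt (term π′) x _) y (δ p h +_))  ≲⟨ sum-mono pointwise ⟩
      D-except x π                                            ∎
      where
      open ≤-Reasoning
      pointwise : ∀ i → updateAt (updateAt (term π′) x (λ _ → 0#)) y (δ p h +_) i
                      ≤ updateAt (term π) x (λ _ → 0#) i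
      pointwise i with i ≟ y | i ≟ x
      ... | yes refl | _ = begin
        updateAt (updateAt (term π′) x _) y (δ p h +_) y ≡⟨ updateAt-updates y _ ⟩
        δ p h + updateAt (term π′) x _ y                ≡⟨ cong (δ p h +_) y-untouched ⟩
        δ p h + δ (π′ ⟨$⟩ˡ y) (σ ⟨$⟩ˡ y)               ≡⟨ cong₂ (λ u v → δ p h + δ u v) y-home (inverseˡ σ) ⟩
        δ p h + δ h h                                   ≲⟨ +-mono-≤ ≤-refl (δ-diagonal h) ⟩
        δ p h + 0#                                      ≈⟨ identityʳ _ ⟩
        δ p h                                           ≡⟨ cong (δ p) (inverseˡ σ) ⟨
        term π y                                        ≡⟨ updateAt-minimal y x (term π) y≢x ⟨
        updateAt (term π) x _ y                         ∎
        where
        y-untouched = updateAt-minimal y x (term π′) y≢x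
        y-home = transpose∘ₚ-matchˡ π refl
      ... | no i≢y | yes refl = begin
        updateAt (updateAt (term π′) x _) y (δ p h +_) x ≡⟨ updateAt-minimal x y _ i≢y ⟩
        updateAt (term π′) x (λ _ → 0#) x               ≡⟨ updateAt-updates x (term π′) ⟩
        0#                                              ≡⟨ updateAt-updates x (term π) ⟨
        updateAt (term π) x (λ _ → 0#) x                ∎
      ... | no i≢y | no i≢x = begin
        updateAt (updateAt (term π′) x _) y (δ p h +_) i ≡⟨ updateAt-minimal i y _ i≢y ⟩
        updateAt (term π′) x _ i                        ≡⟨ updateAt-minimal i x (term π′) i≢x ⟩
        term π′ i                                       ≡⟨ cong (λ k → δ k (σ ⟨$⟩ˡ i)) i-unmoved ⟩
        term π i                                        ≡⟨ updateAt-minimal i x (term π) i≢x ⟨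
        updateAt (term π) x _ i                         ∎
        where
        i-unmoved = transpose∘ₚ-mismatch π (i≢y ∘ ⟨$⟩ˡ-injective π) (i≢x ∘ ⟨$⟩ˡ-injective π)

    extend : ReachableWithin π′ (2× D-except x π′) → ReachableWithin π (2× D-except x π)
    extend (us , us-tf , us≤) with transpositionsAlongShortestPath p≢h
    ... | ts , ts-ph , ts≤ = ts ++ us , Transforms-++ π σ ts (transpose p h) ts-ph us-tf , bound
      where
      open ≤-Reasoning
      bound : cost (ts ++ us) ≤ 2× D-except x π
      bound = begin
        cost (ts ++ us)                  ≈⟨ seqWeight-++ φ ts us ⟩
        cost ts + cost us                ≲⟨ +-mono-≤ ts≤ us≤ ⟩
        2× δ p h + 2× D-except x π′      ≈⟨ 2×-distrib _ _ ⟨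
        2× (δ p h + D-except x π′)       ≲⟨ 2×-mono D-except-decreases ⟩
        2× D-except x π                  ∎

  mutual
    reach : ∀ π → Acc _⊃_ (matched π) → ReachableWithin π (2× D π)
    reach π acc-π with all? (λ i → π ⟨$⟩ˡ i ≟ σ ⟨$⟩ˡ i)
    ... | yes sorted = [] , ⟨$⟩ˡ≡⇒Transforms-[] π σ sorted , +-nonneg (D-nonneg π) (D-nonneg π)
    ... | no unsorted =
      let x , x-misplaced = ¬∀⟶∃¬ n _ (λ i → π ⟨$⟩ˡ i ≟ σ ⟨$⟩ˡ i) unsorted in
      ReachableWithin-mono {π} (2×-mono (D-except≤D x π))
        (reach-except π acc-π x x-misplaced)

    reach-except : ∀ π → Acc _⊃_ (matched π) → ∀ x → π ⟨$⟩ˡ x ≢ σ ⟨$⟩ˡ x →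
                   ReachableWithin π (2× D-except x π)
    reach-except π (acc rec) x x-misplaced = extend (continue (π′ ⟨$⟩ˡ x ≟ σ ⟨$⟩ˡ x))
      where
      open SendHome π x x-misplaced
      continue : Dec (π′ ⟨$⟩ˡ x ≡ σ ⟨$⟩ˡ x) → ReachableWithin π′ (2× D-except x π′)
      continue (yes x-home) =
        ReachableWithin-mono {π′} (2×-mono (D≤D-except {π = π′} x-home))
          (reach π′ (rec matched-grows))
      continue (no x-away) = reach-except π′ (rec matched-grows) x x-away

  upper-bound : ∀ π → ReachableWithin π (2× D π)
  upper-bound π = reach π (⊃-wellFounded (matched π))

open import Data.Nat.Base using (_≤_)

mainTheorem1 : ∀ {c ℓ₁ ℓ₂} (W : WeightDomain c ℓ₁ ℓ₂) (n : ℕ) → 2 ≤ n →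
    (φ : Fin n → Fin n → WeightDomain.Carrier W) → IsWeightFunction W φ →
    (δ : Fin n → Fin n → WeightDomain.Carrier W) → IsMinPathWeight W φ δ →
    (π σ : Permutation′ n) →
    (∀ (ts : List (Transposition {n})) → Transforms ts π σ →
       WeightDomain._≤_ W (Dist W δ π σ) (WeightDomain.2×_ W (seqWeight W φ ts)))
    × Σ (List (Transposition {n})) (λ ts → Transforms ts π σ ×
         WeightDomain._≤_ W (seqWeight W φ ts) (WeightDomain.2×_ W (Dist W δ π σ)))
mainTheorem1 W n _ φ φ-weight δ δ-minimal π σ =
  (λ ts → lower-bound ts π) , upper-bound π
  where open TranspositionDistance W φ-weight δ-minimal σ
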